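{- Let $G$ be a connected graph of order $n$. Then $\overline{\mathrm{lcs}}(G)=n-1$ if and only if $G$ has a vertex $v$ for which $\chi(G\setminus v)=\chi(G)-1=\deg(v)$.
   Context: For a graph $G=(V,E)$ and an integer $k\ge\chi(G)$, a proper $k$-colouring is a map $c\colon V\to\{1,\dots,k\}$ with adjacent vertices receiving different colours. A determining set for $(G,c)$ is a set $S\subseteq V$ such that there is no proper $k$-colouring $c'\neq c$ of $G$ with $c'(s)=c(s)$ for all $s\in S$. A critical set for $(G,c)$ is an inclusion-minimal determining set. $\mathrm{lcs}(G,c)$ is the maximum size of a critical set for $(G,c)$, and $\overline{\mathrm{lcs}}(G,k)$ is the maximum of $\mathrm{lcs}(G,c)$ over all proper $k$-colourings $c$; $\overline{\mathrm{lcs}}(G)=\overline{\mathrm{lcs}}(G,\chi(G))$. -}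

module Defs where

open import Data.Nat using (ℕ; zero; suc; _≤_)
open import Data.Bool using (Bool; true; false)
open import Data.Fin using (Fin; punchIn)
open import Data.Fin.Subset using (Subset; _∈_; _⊂_; ∣_∣)
open import Data.Vec using (tabulate)
open import Data.Product using (Σ; _×_; _,_; ∃)
open import Relation.Nullary using (¬_)
open import Relation.Binary.PropositionalEquality using (_≡_; _≢_)

record Graph (n : ℕ) : Set where
  field
    Adj    : Fin n → Fin n → Bool
    sym    : ∀ u v → Adj u v ≡ Adj v u
    irrefl : ∀ v → Adj v v ≡ false
open Graph public

data Reach {n : ℕ} (G : Graph n) : Fin n → Fin n → Set where
  here : ∀ {u} → Reach G u u
  step : ∀ {u w v} → Adj G u w ≡ true → Reach G w v → Reach G u v

Connected : ∀ {n} → Graph n → Set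
Connected G = ∀ u v → Reach G u v

neighbourhood : ∀ {n} → Graph n → Fin n → Subset n
neighbourhood G v = tabulate (Adj G v)

deg : ∀ {n} → Graph n → Fin n → ℕ
deg G v = ∣ neighbourhood G v ∣

delete : ∀ {m} → Graph (suc m) → Fin (suc m) → Graph m
delete G v = record
  { Adj    = λ i j → Adj G (punchIn v i) (punchIn v j)
  ; sym    = λ i j → sym G (punchIn v i) (punchIn v j)
  ; irrefl = λ i → irrefl G (punchIn v i)
  }

Colouring : ℕ → ℕ → Set
Colouring n k = Fin n → Fin k

Proper : ∀ {n k} → Graph n → Colouring n k → Set
Proper G c = ∀ u v → Adj G u v ≡ true → c u ≢ c v

IsChromaticNumber : ∀ {n} → Graph n → ℕ → Set
IsChromaticNumber {n} G k =
  (Σ (Colouring n k) (Proper G)) ×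
  (∀ m → Σ (Colouring n m) (Proper G) → k ≤ m)

Determining : ∀ {n k} → Graph n → Colouring n k → Subset n → Set
Determining {n} {k} G c S =
  ¬ (Σ (Colouring n k) λ c' → Proper G c' × (∃ λ v → c' v ≢ c v) × (∀ s → s ∈ S → c' s ≡ c s))

Critical : ∀ {n k} → Graph n → Colouring n k → Subset n → Set
Critical G c S = Determining G c S × (∀ T → T ⊂ S → ¬ Determining G c T)

IsLcsBar : ∀ {n} → Graph n → ℕ → ℕ → Set
IsLcsBar {n} G k L =
  (Σ (Colouring n k) λ c → Proper G c × Σ (Subset n) λ S → Critical G c S × ∣ S ∣ ≡ L) ×
  (∀ (c : Colouring n k) → Proper G c → ∀ S → Critical G c S → ∣ S ∣ ≤ L)

{-# OPTIONS --safe #-}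
-- Call u dominant for a colouring c if the neighbours of u carry every colour other than c u.
-- In a χ-colouring every colour class has a dominant vertex: otherwise each vertex of the class
-- moves to a colour it misses and χ − 1 colours suffice. A proper colouring that agrees with c
-- off a dominant u also agrees at u, so V ∖ {u} is determining and V is never critical.
--
-- A critical set of size n − 1 is V ∖ {v}. Minimality makes v dominant, and makes every u ≠ v
-- non-dominant whenever the neighbours of v other than u still carry all colours ≠ c v (otherwise
-- V ∖ {u, v} would be determining). This applies to the whole class of c v in G ∖ v, which thus
-- recolours away, so χ(G ∖ v) = χ − 1; and to the whole class of two equally coloured neighbours
-- of v, which is impossible, so the χ − 1 colours around v are distinct and deg v = χ − 1.
-- Conversely, colour G ∖ v with χ − 1 colours and give v a fresh one: v is dominant (its class is
-- {v}), so V ∖ {v} is determining and, by the degree condition, its neighbours have distinct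
-- colours; a proper subset missing x is not determining, as x can take the fresh colour
-- (swapping colours with v when adjacent).
module Submission where

open import Data.Bool using (true)
open import Data.Bool.Properties using () renaming (_≟_ to _≟ᵇ_)
open import Data.Empty using (⊥-elim)
open import Data.Fin using (Fin; zero; suc; _≟_; punchIn; punchOut; fromℕ; inject₁)
open import Data.Fin.Properties
  using (any?; all?; ¬∀⟶∃¬; suc-injective; 0≢1+n; punchInᵢ≢i; punchIn-punchOut; punchOut-injective;
         fromℕ≢inject₁; inject₁-injective)
open import Data.Fin.Subset using (Subset; _∈_; _∉_; _⊆_; _⊂_; ∣_∣; ⁅_⁆; ∁; _-_; ⊤; inside; outside)
open import Data.Fin.Subset.Properties
  using (_∈?_; ∈⊤; ⊆-antisym; x∈⁅x⁆; x≢y⇒x∉⁅y⁆; x∉⁅y⁆⇒x≢y; x∈p⇒x∉∁p; x∈∁p⇒x∉p; x∉p⇒x∈∁p;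
         ∣p∣≤n; ∣⊤∣≡n; ∣p∣≡n⇒p≡⊤; ∣⁅x⁆∣≡1; ∣∁p∣≡n∸∣p∣; p⊆q⇒∣p∣≤∣q∣; p⊂q⇒∣p∣<∣q∣;
         x∈p∧x≢y⇒x∈p-y; x∈p⇒p-x⊂p; x∈p⇒∣p-x∣<∣p∣)
open import Data.Nat using (ℕ; zero; suc; _∸_; _≤_; _<_; _≤?_; z≤n; s≤s)
open import Data.Nat.Properties using (≤-trans; ≤-antisym; ≤-reflexive; ≤-pred; n≮n; ≰⇒>; ≤-<-trans; <-≤-trans)
open import Data.Product using (Σ; _×_; _,_; proj₁; proj₂; ∃)
open import Data.Vec.Base using ([]; _∷_; here; there)
open import Data.Vec.Properties using (lookup∘tabulate; []=⇒lookup; lookup⇒[]=)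
open import Data.Vec.Functional using (updateAt; insertAt; removeAt)
open import Data.Vec.Functional.Properties using (updateAt-updates; updateAt-minimal; insertAt-lookup; insertAt-punchIn)
open import Function using (_∘_; const)
open import Function.Bundles using (_⇔_; mk⇔; Equivalence)
open import Relation.Nullary using (¬_; Dec; yes; no)
open import Relation.Nullary.Decidable using (_×-dec_; _→-dec_; ¬?)
open import Relation.Binary.PropositionalEquality using (_≡_; _≢_; refl; sym; trans; cong; subst; subst₂)

open import Defs hiding (sym)

-- Subsets of Fin n

x≢y⇒x∈∁⁅y⁆ : ∀ {n} {x y : Fin n} → x ≢ y → x ∈ ∁ ⁅ y ⁆
x≢y⇒x∈∁⁅y⁆ = x∉p⇒x∈∁p ∘ x≢y⇒x∉⁅y⁆

x∈∁⁅y⁆⇒x≢y : ∀ {n} {x y : Fin n} → x ∈ ∁ ⁅ y ⁆ → x ≢ y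
x∈∁⁅y⁆⇒x≢y = x∉⁅y⁆⇒x≢y ∘ x∈∁p⇒x∉p

x∈p∧y∉p⇒x≢y : ∀ {n} {x y : Fin n} {p : Subset n} → x ∈ p → y ∉ p → x ≢ y
x∈p∧y∉p⇒x≢y x∈p y∉p refl = y∉p x∈p

∣∁⁅x⁆∣≡n∸1 : ∀ {n} (x : Fin n) → ∣ ∁ ⁅ x ⁆ ∣ ≡ n ∸ 1
∣∁⁅x⁆∣≡n∸1 {n} x = trans (∣∁p∣≡n∸∣p∣ ⁅ x ⁆) (cong (n ∸_) (∣⁅x⁆∣≡1 x))

∣p∣≡n⇒p≡∁⁅x⁆ : ∀ {n} {p : Subset (suc n)} → ∣ p ∣ ≡ n → ∃ λ x → p ≡ ∁ ⁅ x ⁆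
∣p∣≡n⇒p≡∁⁅x⁆ {n} {p} ∣p∣≡n with all? (_∈? p)
... | yes p-full = ⊥-elim (n≮n n (subst₂ _≤_ (∣⊤∣≡n (suc n)) ∣p∣≡n (p⊆q⇒∣p∣≤∣q∣ {p = ⊤} (λ {x} _ → p-full x))))
... | no ¬p-full with ¬∀⟶∃¬ _ _ (_∈? p) ¬p-full
...   | x , x∉p = x , ⊆-antisym p⊆∁⁅x⁆ ∁⁅x⁆⊆p
  where
  p⊆∁⁅x⁆ : p ⊆ ∁ ⁅ x ⁆
  p⊆∁⁅x⁆ w∈p = x≢y⇒x∈∁⁅y⁆ λ { refl → x∉p w∈p }
  ∁⁅x⁆⊆p : ∁ ⁅ x ⁆ ⊆ p
  ∁⁅x⁆⊆p {w} w∈∁⁅x⁆ with w ∈? p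
  ... | yes w∈p = w∈p
  ... | no w∉p = ⊥-elim (n≮n n (subst₂ _<_ ∣p∣≡n (∣∁⁅x⁆∣≡n∸1 x)
                                    (p⊂q⇒∣p∣<∣q∣ (p⊆∁⁅x⁆ , w , w∈∁⁅x⁆ , w∉p))))

module _ {n k} (f : Fin n → Fin k) where

  MapsTo : Subset n → Subset k → Set
  MapsTo p q = ∀ {x} → x ∈ p → f x ∈ q

  InjectiveOn : Subset n → Set
  InjectiveOn p = ∀ {x y} → x ∈ p → y ∈ p → f x ≡ f y → x ≡ y

  Onto : Subset n → Subset k → Set
  Onto p q = ∀ {j} → j ∈ q → ∃ λ x → x ∈ p × f x ≡ j

injective⇒∣p∣≤∣q∣ : ∀ {n k} (f : Fin n → Fin k) {p q} → MapsTo f p q → InjectiveOn f p → ∣ p ∣ ≤ ∣ q ∣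
injective⇒∣p∣≤∣q∣ f {[]} _ _ = z≤n
injective⇒∣p∣≤∣q∣ f {outside ∷ p} maps injective =
  injective⇒∣p∣≤∣q∣ (f ∘ suc) (maps ∘ there) (λ x∈p y∈p → suc-injective ∘ injective (there x∈p) (there y∈p))
injective⇒∣p∣≤∣q∣ f {inside ∷ p} {q} maps injective =
  ≤-trans (s≤s (injective⇒∣p∣≤∣q∣ (f ∘ suc) maps′ injective′)) (x∈p⇒∣p-x∣<∣p∣ (maps here))
  where
  maps′ : MapsTo (f ∘ suc) p (q - f zero)
  maps′ x∈p = x∈p∧x≢y⇒x∈p-y (maps (there x∈p)) (0≢1+n ∘ sym ∘ injective (there x∈p) here)
  injective′ : InjectiveOn (f ∘ suc) p
  injective′ x∈p y∈p = suc-injective ∘ injective (there x∈p) (there y∈p)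

surjective⇒∣q∣≤∣p∣ : ∀ {n k} (f : Fin (suc n) → Fin k) {p q} → Onto f p q → ∣ q ∣ ≤ ∣ p ∣
surjective⇒∣q∣≤∣p∣ {n} {k} f {p} {q} onto = injective⇒∣p∣≤∣q∣ section (proj₁ ∘ section-spec) section-injective
  where
  preimage? : ∀ j → Dec (∃ λ x → x ∈ p × f x ≡ j)
  preimage? j = any? λ x → (x ∈? p) ×-dec (f x ≟ j)
  section : Fin k → Fin (suc n)
  section j with preimage? j
  ... | yes (x , _) = x
  ... | no _ = zero
  section-spec : ∀ {j} → j ∈ q → section j ∈ p × f (section j) ≡ j
  section-spec {j} j∈q with preimage? j
  ... | yes (_ , spec) = spec
  ... | no none = ⊥-elim (none (onto j∈q))
  section-injective : InjectiveOn section q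
  section-injective i∈q j∈q eq =
    trans (sym (proj₂ (section-spec i∈q))) (trans (cong f eq) (proj₂ (section-spec j∈q)))

surjective∧∣p∣≤∣q∣⇒injective : ∀ {n k} (f : Fin (suc n) → Fin k) {p q} →
  Onto f p q → ∣ p ∣ ≤ ∣ q ∣ → InjectiveOn f p
surjective∧∣p∣≤∣q∣⇒injective f {p} {q} onto ∣p∣≤∣q∣ {x} {y} x∈p y∈p fx≡fy with x ≟ y
... | yes x≡y = x≡y
... | no x≢y = ⊥-elim (n≮n ∣ q ∣ (<-≤-trans (≤-<-trans ∣q∣≤∣p-y∣ (x∈p⇒∣p-x∣<∣p∣ y∈p)) ∣p∣≤∣q∣))
  where
  onto-p-y : Onto f (p - y) q
  onto-p-y j∈q with onto j∈q
  ... | w , w∈p , fw≡j with w ≟ y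
  ...   | no w≢y = w , x∈p∧x≢y⇒x∈p-y w∈p w≢y , fw≡j
  ...   | yes refl = x , x∈p∧x≢y⇒x∈p-y x∈p x≢y , trans fx≡fy fw≡j
  ∣q∣≤∣p-y∣ : ∣ q ∣ ≤ ∣ p - y ∣
  ∣q∣≤∣p-y∣ = surjective⇒∣q∣≤∣p∣ f onto-p-y

-- Colourings

NeedsColours : ∀ {n} → Graph n → ℕ → Set
NeedsColours {n} G k = ∀ j → Σ (Colouring n j) (Proper G) → k ≤ j

recolour : ∀ {n k} → Colouring n k → Fin n → Fin k → Colouring n k
recolour c x d = updateAt c x (const d)

recolour-at : ∀ {n k} (c : Colouring n k) x d → recolour c x d x ≡ d
recolour-at c x d = updateAt-updates x c

recolour-off : ∀ {n k} (c : Colouring n k) x d {w} → w ≢ x → recolour c x d w ≡ c w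
recolour-off c x d {w} = updateAt-minimal w x c

extend : ∀ {m k} → Fin (suc m) → Colouring m k → Colouring (suc m) (suc k)
extend {k = k} v e = insertAt (inject₁ ∘ e) v (fromℕ k)

extend-at : ∀ {m k} v (e : Colouring m k) → extend v e v ≡ fromℕ k
extend-at v e = insertAt-lookup (inject₁ ∘ e) v _

extend-punchIn : ∀ {m k} v (e : Colouring m k) i → extend v e (punchIn v i) ≡ inject₁ (e i)
extend-punchIn v e = insertAt-punchIn (inject₁ ∘ e) v _

data PunchView {m} (v : Fin (suc m)) : Fin (suc m) → Set where
  at      : PunchView v v
  punched : ∀ i → PunchView v (punchIn v i)

punchView : ∀ {m} (v w : Fin (suc m)) → PunchView v w
punchView v w with v ≟ w
... | yes refl = at
... | no v≢w = subst (PunchView v) (punchIn-punchOut v≢w) (punched (punchOut v≢w))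

extend-fresh : ∀ {m k} v (e : Colouring m k) {w} → extend v e w ≡ extend v e v → w ≡ v
extend-fresh v e {w} eq with punchView v w
... | at = refl
... | punched i = ⊥-elim (fromℕ≢inject₁ (trans (sym (extend-at v e)) (trans (sym eq) (extend-punchIn v e i))))

module _ {n} (G : Graph n) where

  adj⇒≢ : ∀ {u w} → Adj G u w ≡ true → u ≢ w
  adj⇒≢ {u} a refl with () ← trans (sym a) (irrefl G u)

  adj-sym : ∀ {u w} → Adj G u w ≡ true → Adj G w u ≡ true
  adj-sym {u} {w} a = trans (Graph.sym G w u) a

  ∈-neighbourhood : ∀ {u w} → Adj G u w ≡ true → w ∈ neighbourhood G u
  ∈-neighbourhood {u} {w} a = lookup⇒[]= w _ (trans (lookup∘tabulate (Adj G u) w) a)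

  ∈-neighbourhood⁻ : ∀ {u w} → w ∈ neighbourhood G u → Adj G u w ≡ true
  ∈-neighbourhood⁻ {u} {w} w∈N = trans (sym (lookup∘tabulate (Adj G u) w)) ([]=⇒lookup w∈N)

  Dominant : ∀ {k} → Colouring n k → Fin n → Set
  Dominant c u = ∀ d → d ≢ c u → ∃ λ w → Adj G u w ≡ true × c w ≡ d

  MissesColour : ∀ {k} → Colouring n k → Fin n → Set
  MissesColour c u = ∃ λ d → d ≢ c u × (∀ w → Adj G u w ≡ true → c w ≢ d)

  Rainbow : ∀ {k} → Colouring n k → Fin n → Set
  Rainbow c v = ∀ {u₁ u₂} → Adj G v u₁ ≡ true → Adj G v u₂ ≡ true → c u₁ ≡ c u₂ → u₁ ≡ u₂

  module _ {k} (c : Colouring n k) (u : Fin n) where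

    private
      shown? : ∀ d → Dec (d ≢ c u → ∃ λ w → Adj G u w ≡ true × c w ≡ d)
      shown? d = ¬? (d ≟ c u) →-dec any? λ w → (Adj G u w ≟ᵇ true) ×-dec (c w ≟ d)

    dominant? : Dec (Dominant c u)
    dominant? = all? shown?

    ¬dominant⇒missesColour : ¬ Dominant c u → MissesColour c u
    ¬dominant⇒missesColour ¬dominant with ¬∀⟶∃¬ _ _ shown? ¬dominant
    ... | d , ¬shown with d ≟ c u
    ...   | yes d≡cu = ⊥-elim (¬shown λ d≢cu → ⊥-elim (d≢cu d≡cu))
    ...   | no d≢cu = d , d≢cu , λ w a cw≡d → ¬shown λ _ → w , a , cw≡d

  recolour-proper : ∀ {k} {c : Colouring n k} {x d} →
    (∀ u w → Adj G u w ≡ true → u ≢ x → w ≢ x → c u ≢ c w) →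
    (∀ w → Adj G x w ≡ true → c w ≢ d) → Proper G (recolour c x d)
  recolour-proper {c = c} {x} {d} proper-off-x unseen u w a with u ≟ x | w ≟ x
  ... | yes refl | yes refl = ⊥-elim (adj⇒≢ a refl)
  ... | yes refl | no w≢x = λ eq →
    unseen w a (trans (sym (recolour-off c x d w≢x)) (trans (sym eq) (recolour-at c x d)))
  ... | no u≢x | yes refl = λ eq →
    unseen u (adj-sym a) (trans (sym (recolour-off c x d u≢x)) (trans eq (recolour-at c x d)))
  ... | no u≢x | no w≢x = λ eq →
    proper-off-x u w a u≢x w≢x (trans (sym (recolour-off c x d u≢x)) (trans eq (recolour-off c x d w≢x)))

  recolour-proper′ : ∀ {k} {c : Colouring n k} {x d} → Proper G c →
    (∀ w → Adj G x w ≡ true → c w ≢ d) → Proper G (recolour c x d)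
  recolour-proper′ proper = recolour-proper (λ u w a _ _ → proper u w a)

  swap-proper : ∀ {k} {c : Colouring n k} {v x} → Proper G c → Adj G v x ≡ true →
    (∀ w → Adj G v w ≡ true → w ≢ x → c w ≢ c x) →
    (∀ w → Adj G x w ≡ true → w ≢ v → c w ≢ c v) →
    Proper G (recolour (recolour c v (c x)) x (c v))
  swap-proper {k} {c} {v} {x} proper vx unseen-at-v unseen-at-x = recolour-proper proper-off-x unseen
    where
    c₁ : Colouring n k
    c₁ = recolour c v (c x)
    proper-off-x : ∀ u w → Adj G u w ≡ true → u ≢ x → w ≢ x → c₁ u ≢ c₁ w
    proper-off-x u w a u≢x w≢x with u ≟ v | w ≟ v
    ... | yes refl | yes refl = ⊥-elim (adj⇒≢ a refl)
    ... | yes refl | no w≢v = λ eq →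
      unseen-at-v w a w≢x (trans (sym (recolour-off c v (c x) w≢v)) (trans (sym eq) (recolour-at c v (c x))))
    ... | no u≢v | yes refl = λ eq →
      unseen-at-v u (adj-sym a) u≢x (trans (sym (recolour-off c v (c x) u≢v)) (trans eq (recolour-at c v (c x))))
    ... | no u≢v | no w≢v = λ eq →
      proper u w a (trans (sym (recolour-off c v (c x) u≢v)) (trans eq (recolour-off c v (c x) w≢v)))
    unseen : ∀ w → Adj G x w ≡ true → c₁ w ≢ c v
    unseen w a with w ≟ v
    ... | yes refl = λ eq → proper v x vx (sym (trans (sym (recolour-at c v (c x))) eq))
    ... | no w≢v = λ eq → unseen-at-x w a w≢v (trans (sym (recolour-off c v (c x) w≢v)) eq)

  omitColour : ∀ {k} {c : Colouring n (suc k)} {b} → Proper G c → (∀ u → c u ≢ b) → Σ (Colouring n k) (Proper G)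
  omitColour proper avoids =
    (λ u → punchOut (avoids u ∘ sym)) ,
    λ u w a → proper u w a ∘ punchOut-injective (avoids u ∘ sym) (avoids w ∘ sym)

  recolourClass : ∀ {k} {c : Colouring n (suc k)} → Proper G c → ∀ b → (∀ u → c u ≡ b → MissesColour c u) →
    Σ (Colouring n (suc k)) λ c′ → Proper G c′ × (∀ u → c′ u ≢ b)
  recolourClass {k} {c} proper b misses = c′ , c′-proper , c′-avoids
    where
    c′ : Colouring n (suc k)
    c′ u with c u ≟ b
    ... | yes cu≡b = proj₁ (misses u cu≡b)
    ... | no _ = c u
    c′-avoids : ∀ u → c′ u ≢ b
    c′-avoids u with c u ≟ b
    ... | yes cu≡b = λ d≡b → proj₁ (proj₂ (misses u cu≡b)) (trans d≡b (sym cu≡b))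
    ... | no cu≢b = cu≢b
    c′-proper : Proper G c′
    c′-proper u w a with c u ≟ b | c w ≟ b
    ... | yes cu≡b | yes cw≡b = λ _ → proper u w a (trans cu≡b (sym cw≡b))
    ... | yes cu≡b | no _ = λ d≡cw → proj₂ (proj₂ (misses u cu≡b)) w a (sym d≡cw)
    ... | no _ | yes cw≡b = proj₂ (proj₂ (misses w cw≡b)) u (adj-sym a)
    ... | no _ | no _ = proper u w a

  recolourable⇒fewerColours : ∀ {k} {c : Colouring n (suc k)} → Proper G c →
    ∀ b → (∀ u → c u ≡ b → MissesColour c u) → Σ (Colouring n k) (Proper G)
  recolourable⇒fewerColours proper b misses with recolourClass proper b misses
  ... | _ , proper′ , avoids = omitColour proper′ avoids

  classNotRecolourable : ∀ {k} {c : Colouring n (suc k)} → NeedsColours G (suc k) → Proper G c →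
    ∀ b → ¬ (∀ u → c u ≡ b → MissesColour c u)
  classNotRecolourable {k} needs proper b misses = n≮n k (needs k (recolourable⇒fewerColours proper b misses))

  ∃dominant : ∀ {k} {c : Colouring n (suc k)} → NeedsColours G (suc k) → Proper G c → ∃ (Dominant c)
  ∃dominant {c = c} needs proper with any? (dominant? c)
  ... | yes found = found
  ... | no none = ⊥-elim (classNotRecolourable needs proper zero
                            λ u _ → ¬dominant⇒missesColour c u (none ∘ (u ,_)))

  colour-forced : ∀ {k} {c′ : Colouring n k} {u b} → Proper G c′ →
    (∀ d → d ≢ b → ∃ λ w → Adj G u w ≡ true × c′ w ≡ d) → c′ u ≡ b
  colour-forced {c′ = c′} {u} {b} proper′ shown with c′ u ≟ b
  ... | yes c′u≡b = c′u≡b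
  ... | no c′u≢b with shown (c′ u) c′u≢b
  ...   | w , a , c′w≡c′u = ⊥-elim (proper′ u w a (sym c′w≡c′u))

  agree-off⇒agree : ∀ {k} {c c′ : Colouring n k} {u} → Proper G c′ → Dominant c u →
    (∀ w → w ≢ u → c′ w ≡ c w) → ∀ w → c′ w ≡ c w
  agree-off⇒agree {c = c} {c′} {u} proper′ dominant agree-off w with w ≟ u
  ... | no w≢u = agree-off w w≢u
  ... | yes refl = colour-forced proper′ shown
    where
    shown : ∀ d → d ≢ c w → ∃ λ w′ → Adj G w w′ ≡ true × c′ w′ ≡ d
    shown d d≢cw with dominant d d≢cw
    ... | w′ , a , cw′≡d = w′ , a , trans (agree-off w′ (adj⇒≢ a ∘ sym)) cw′≡d

  module _ {k} {c : Colouring n k} where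

    rigid⇒determining : ∀ {T} → (∀ c′ → Proper G c′ → (∀ s → s ∈ T → c′ s ≡ c s) → ∀ w → c′ w ≡ c w) →
      Determining G c T
    rigid⇒determining rigid (c′ , proper′ , (x , c′x≢cx) , agree) = c′x≢cx (rigid c′ proper′ agree x)

    recoloured⇒¬determining : ∀ {T} {c′ : Colouring n k} {x} → Proper G c′ → c′ x ≢ c x →
      (∀ s → s ∈ T → c′ s ≡ c s) → ¬ Determining G c T
    recoloured⇒¬determining {c′ = c′} {x} proper′ c′x≢cx agree determining =
      determining (c′ , proper′ , (x , c′x≢cx) , agree)

    dominant⇒determining : ∀ {u T} → Dominant c u → ∁ ⁅ u ⁆ ⊆ T → Determining G c T
    dominant⇒determining dominant ∁⁅u⁆⊆T = rigid⇒determining λ c′ proper′ agree →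
      agree-off⇒agree proper′ dominant λ w w≢u → agree w (∁⁅u⁆⊆T (x≢y⇒x∈∁⁅y⁆ w≢u))

    determining⇒dominant : ∀ {v T} → Proper G c → Determining G c T → v ∉ T → Dominant c v
    determining⇒dominant {v} proper determining v∉T with dominant? c v
    ... | yes dominant = dominant
    ... | no ¬dominant with ¬dominant⇒missesColour c v ¬dominant
    ...   | d , d≢cv , unseen = ⊥-elim (recoloured⇒¬determining
              (recolour-proper′ proper unseen)
              (λ eq → d≢cv (trans (sym (recolour-at c v d)) eq))
              (λ s s∈T → recolour-off c v d λ { refl → v∉T s∈T })
              determining)

    -- v is rigid as long as its neighbours other than u agree, and then u is rigid because v is.
    dominantPair⇒determining : ∀ {u v} → Dominant c u →
      (∀ d → d ≢ c v → ∃ λ w → Adj G v w ≡ true × w ≢ u × c w ≡ d) → Determining G c (∁ ⁅ v ⁆ - u)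
    dominantPair⇒determining {u} {v} dominant-u shown-at-v = rigid⇒determining rigid
      where
      rigid : ∀ c′ → Proper G c′ → (∀ s → s ∈ ∁ ⁅ v ⁆ - u → c′ s ≡ c s) → ∀ w → c′ w ≡ c w
      rigid c′ proper′ agree = agree-off⇒agree proper′ dominant-u agree-off-u
        where
        agree-off-uv : ∀ w → w ≢ u → w ≢ v → c′ w ≡ c w
        agree-off-uv w w≢u w≢v = agree w (x∈p∧x≢y⇒x∈p-y (x≢y⇒x∈∁⁅y⁆ w≢v) w≢u)
        agree-at-v : c′ v ≡ c v
        agree-at-v = colour-forced proper′ λ d d≢cv →
          let (w , a , w≢u , cw≡d) = shown-at-v d d≢cv
          in w , a , trans (agree-off-uv w w≢u (adj⇒≢ a ∘ sym)) cw≡d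
        agree-off-u : ∀ w → w ≢ u → c′ w ≡ c w
        agree-off-u w w≢u with w ≟ v
        ... | yes refl = agree-at-v
        ... | no w≢v = agree-off-uv w w≢u w≢v

module _ {m} (G : Graph (suc m)) where

  extend-proper : ∀ {k v} {e : Colouring m k} → Proper (delete G v) e → Proper G (extend v e)
  extend-proper {v = v} {e} proper u w a with punchView v u | punchView v w
  ... | at | at = ⊥-elim (adj⇒≢ G a refl)
  ... | at | punched j = λ eq → fromℕ≢inject₁ (trans (sym (extend-at v e)) (trans eq (extend-punchIn v e j)))
  ... | punched i | at = λ eq → fromℕ≢inject₁ (trans (sym (extend-at v e)) (trans (sym eq) (extend-punchIn v e i)))
  ... | punched i | punched j = λ eq →
    proper i j a (inject₁-injective (trans (sym (extend-punchIn v e i)) (trans eq (extend-punchIn v e j))))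

  removeAt-proper : ∀ {k} {c : Colouring (suc m) k} {v} → Proper G c → Proper (delete G v) (removeAt c v)
  removeAt-proper {v = v} proper i j = proper (punchIn v i) (punchIn v j)

  needsColours-delete : ∀ {k} v → NeedsColours G (suc k) → NeedsColours (delete G v) k
  needsColours-delete v needs j (e , proper) = ≤-pred (needs (suc j) (extend v e , extend-proper proper))

  rainbow⇔deg≡ : ∀ {k} {c : Colouring (suc m) (suc k)} {v} → Proper G c → Dominant G c v →
    Rainbow G c v ⇔ deg G v ≡ k
  rainbow⇔deg≡ {k} {c} {v} proper dominant = mk⇔ rainbow⇒deg≡k deg≡k⇒rainbow
    where
    ∣∁⁅cv⁆∣≡k : ∣ ∁ ⁅ c v ⁆ ∣ ≡ k
    ∣∁⁅cv⁆∣≡k = ∣∁⁅x⁆∣≡n∸1 (c v)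
    maps : MapsTo c (neighbourhood G v) (∁ ⁅ c v ⁆)
    maps w∈N = x≢y⇒x∈∁⁅y⁆ (proper v _ (∈-neighbourhood⁻ G w∈N) ∘ sym)
    onto : Onto c (neighbourhood G v) (∁ ⁅ c v ⁆)
    onto j∈∁⁅cv⁆ with dominant _ (x∈∁⁅y⁆⇒x≢y j∈∁⁅cv⁆)
    ... | w , a , cw≡j = w , ∈-neighbourhood G a , cw≡j
    rainbow⇒deg≡k : Rainbow G c v → deg G v ≡ k
    rainbow⇒deg≡k rainbow = ≤-antisym
      (subst (deg G v ≤_) ∣∁⁅cv⁆∣≡k (injective⇒∣p∣≤∣q∣ c maps λ x∈N y∈N →
        rainbow (∈-neighbourhood⁻ G x∈N) (∈-neighbourhood⁻ G y∈N)))
      (subst (_≤ deg G v) ∣∁⁅cv⁆∣≡k (surjective⇒∣q∣≤∣p∣ c onto))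
    deg≡k⇒rainbow : deg G v ≡ k → Rainbow G c v
    deg≡k⇒rainbow deg≡k a₁ a₂ =
      surjective∧∣p∣≤∣q∣⇒injective c onto (≤-reflexive (trans deg≡k (sym ∣∁⁅cv⁆∣≡k)))
        (∈-neighbourhood G a₁) (∈-neighbourhood G a₂)

  critical⇒∣S∣≤m : ∀ {k} {c : Colouring (suc m) (suc k)} {S} → NeedsColours G (suc k) → Proper G c →
    Critical G c S → ∣ S ∣ ≤ m
  critical⇒∣S∣≤m {S = S} needs proper (_ , minimal) with ∣ S ∣ ≤? m
  ... | yes ∣S∣≤m = ∣S∣≤m
  ... | no ∣S∣≰m with ∃dominant G needs proper
  ...   | u , dominant = ⊥-elim (minimal (S - u) (x∈p⇒p-x⊂p ∈S)
            (dominant⇒determining G dominant λ w∈∁⁅u⁆ → x∈p∧x≢y⇒x∈p-y ∈S (x∈∁⁅y⁆⇒x≢y w∈∁⁅u⁆)))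
    where
    ∈S : ∀ {w} → w ∈ S
    ∈S {w} = subst (w ∈_) (sym (∣p∣≡n⇒p≡⊤ (≤-antisym (∣p∣≤n S) (≰⇒> ∣S∣≰m)))) ∈⊤

module Forward {m k} (G : Graph (suc m)) (needs : NeedsColours G (suc k))
  {c : Colouring (suc m) (suc k)} (proper : Proper G c) (v : Fin (suc m)) (critical : Critical G c (∁ ⁅ v ⁆)) where

  v-dominant : Dominant G c v
  v-dominant = determining⇒dominant G proper (proj₁ critical) (x∈p⇒x∉∁p (x∈⁅x⁆ v))

  ShownAvoiding : Fin (suc m) → Set
  ShownAvoiding u = ∀ d → d ≢ c v → ∃ λ w → Adj G v w ≡ true × w ≢ u × c w ≡ d

  missesColour : ∀ {u} → u ≢ v → ShownAvoiding u → MissesColour G c u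
  missesColour {u} u≢v shown with dominant? G c u
  ... | no ¬dominant = ¬dominant⇒missesColour G c u ¬dominant
  ... | yes dominant = ⊥-elim (proj₂ critical (∁ ⁅ v ⁆ - u) (x∈p⇒p-x⊂p (x≢y⇒x∈∁⁅y⁆ u≢v))
                                 (dominantPair⇒determining G dominant shown))

  shownAvoiding-sameColour : ∀ {u} → c u ≡ c v → ShownAvoiding u
  shownAvoiding-sameColour cu≡cv d d≢cv with v-dominant d d≢cv
  ... | w , a , cw≡d = w , a , (λ { refl → proper v w a (sym cu≡cv) }) , cw≡d

  χ-delete : IsChromaticNumber (delete G v) k
  χ-delete = recolourable⇒fewerColours (delete G v) (removeAt-proper G proper) (c v) misses ,
             needsColours-delete G v needs
    where
    misses : ∀ i → c (punchIn v i) ≡ c v → MissesColour (delete G v) (removeAt c v) i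
    misses i ci≡cv with missesColour (punchInᵢ≢i v i) (shownAvoiding-sameColour ci≡cv)
    ... | d , d≢ci , unseen = d , d≢ci , λ j → unseen (punchIn v j)

  v-rainbow : Rainbow G c v
  v-rainbow {u₁} {u₂} a₁ a₂ cu₁≡cu₂ with u₁ ≟ u₂
  ... | yes u₁≡u₂ = u₁≡u₂
  ... | no u₁≢u₂ = ⊥-elim (classNotRecolourable G needs proper (c u₁) λ u cu≡cu₁ →
                            missesColour (λ { refl → proper v u₁ a₁ cu≡cu₁ }) (shown u cu≡cu₁))
    where
    other : ∀ u → ∃ λ w → Adj G v w ≡ true × w ≢ u × c w ≡ c u₁
    other u with u ≟ u₁
    ... | yes refl = u₂ , a₂ , u₁≢u₂ ∘ sym , sym cu₁≡cu₂
    ... | no u≢u₁ = u₁ , a₁ , u≢u₁ ∘ sym , refl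
    shown : ∀ u → c u ≡ c u₁ → ShownAvoiding u
    shown u cu≡cu₁ d d≢cv with v-dominant d d≢cv
    ... | w , a , cw≡d with w ≟ u
    ...   | no w≢u = w , a , w≢u , cw≡d
    ...   | yes refl with other w
    ...     | w′ , a′ , w′≢w , cw′≡cu₁ = w′ , a′ , w′≢w , trans cw′≡cu₁ (trans (sym cu≡cu₁) cw≡d)

  deg-v : deg G v ≡ k
  deg-v = Equivalence.to (rainbow⇔deg≡ G proper v-dominant) v-rainbow

lcsBar⇒vertex : ∀ {m k} (G : Graph (suc m)) → NeedsColours G (suc k) → IsLcsBar G (suc k) m →
  ∃ λ v → IsChromaticNumber (delete G v) k × deg G v ≡ k
lcsBar⇒vertex G needs ((c , proper , S , critical , ∣S∣≡m) , _) with ∣p∣≡n⇒p≡∁⁅x⁆ {p = S} ∣S∣≡m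
... | v , refl = v , Forward.χ-delete G needs proper v critical , Forward.deg-v G needs proper v critical

module Backward {m k} (G : Graph (suc m)) (needs : NeedsColours G (suc k)) (v : Fin (suc m))
  {e : Colouring m k} (proper-e : Proper (delete G v) e) (deg≡k : deg G v ≡ k) where

  c : Colouring (suc m) (suc k)
  c = extend v e

  proper : Proper G c
  proper = extend-proper G proper-e

  v-dominant : Dominant G c v
  v-dominant with dominant? G c v
  ... | yes dominant = dominant
  ... | no ¬dominant = ⊥-elim (classNotRecolourable G needs proper (c v) λ u cu≡cv →
          subst (MissesColour G c) (sym (extend-fresh v e cu≡cv)) (¬dominant⇒missesColour G c v ¬dominant))

  v-rainbow : Rainbow G c v
  v-rainbow = Equivalence.from (rainbow⇔deg≡ G proper v-dominant) deg≡k

  fresh : ∀ {x} → x ≢ v → c v ≢ c x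
  fresh x≢v = x≢v ∘ extend-fresh v e ∘ sym

  minimal : ∀ T → T ⊂ ∁ ⁅ v ⁆ → ¬ Determining G c T
  minimal T (T⊆∁⁅v⁆ , x , x∈∁⁅v⁆ , x∉T) = byAdjacency (Adj G v x ≟ᵇ true)
    where
    x≢v : x ≢ v
    x≢v = x∈∁⁅y⁆⇒x≢y x∈∁⁅v⁆
    T-off-x : ∀ {s} → s ∈ T → s ≢ x
    T-off-x s∈T = x∈p∧y∉p⇒x≢y s∈T x∉T
    byAdjacency : Dec (Adj G v x ≡ true) → ¬ Determining G c T
    byAdjacency (no ¬vx) = recoloured⇒¬determining G (recolour-proper′ G proper unseen)
      (fresh x≢v ∘ trans (sym (recolour-at c x (c v))))
      (λ s s∈T → recolour-off c x (c v) (T-off-x s∈T))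
      where
      unseen : ∀ w → Adj G x w ≡ true → c w ≢ c v
      unseen w a cw≡cv with extend-fresh v e cw≡cv
      ... | refl = ¬vx (adj-sym G a)
    byAdjacency (yes vx) = recoloured⇒¬determining G
      (swap-proper G proper vx (λ w vw w≢x cw≡cx → w≢x (v-rainbow vw vx cw≡cx)) (λ w _ w≢v → fresh w≢v ∘ sym))
      (fresh x≢v ∘ trans (sym (recolour-at (recolour c v (c x)) x (c v))))
      (λ s s∈T → trans (recolour-off (recolour c v (c x)) x (c v) (T-off-x s∈T))
                       (recolour-off c v (c x) (x∈∁⁅y⁆⇒x≢y (T⊆∁⁅v⁆ s∈T))))

  lcsBar : IsLcsBar G (suc k) m
  lcsBar = (c , proper , ∁ ⁅ v ⁆ , (dominant⇒determining G v-dominant (λ w∈ → w∈) , minimal) , ∣∁⁅x⁆∣≡n∸1 v) ,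
           λ _ proper′ _ → critical⇒∣S∣≤m G needs proper′

mainTheorem2 : ∀ (m : ℕ) (G : Graph (suc m)) → Connected G →
    ∀ (χ : ℕ) → IsChromaticNumber G χ →
    IsLcsBar G χ m ⇔
      (Σ (Fin (suc m)) λ v → Σ ℕ λ χ' →
        IsChromaticNumber (delete G v) χ' × χ' ≡ χ ∸ 1 × deg G v ≡ χ ∸ 1)
mainTheorem2 m G _ zero ((c , _) , _) with () ← c zero
mainTheorem2 m G _ (suc k) (_ , needs) = mk⇔
  (λ lcs → let (v , χ-delete , deg≡k) = lcsBar⇒vertex G needs lcs in v , k , χ-delete , refl , deg≡k)
  (λ { (v , _ , ((e , proper-e) , _) , refl , deg≡k) → Backward.lcsBar G needs v proper-e deg≡k })
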